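{- For all $r,k,s,t\in\mathbb{N}$ such that $t$ and $s$ are powers of $2$ and $t\ge s\ge 2^{k-1}$, \[ f_{r,k}(t,s) \le r\, 2^{2k-2}(t/s)^2. \]
   Context: $J_{r,k}$ is the $r\times k$ matrix all of whose entries are $1$. An interval decomposition of the rows of a matrix is a partition of its rows into nonempty intervals of consecutive rows (similarly for columns); a block decomposition is given by interval decompositions of rows and columns, its blocks being the submatrices on a row interval and a column interval. Contracting the blocks gives the binary matrix with one entry per block, equal to $0$ iff the block is all zeros. A binary matrix $B$ is an interval minor of $A$ if $B$ can be obtained by contracting the blocks of some block decomposition of $A$ and then possibly replacing some $1$-entries by $0$-entries. $f_{r,k}(t,s)$ is the maximum number of rows of a binary matrix with $t$ columns, at least $s$ $1$-entries in every row, that does not have $J_{r,k}$ as an interval minor. -}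

module Defs where

open import Data.Nat using (ℕ; zero; suc; _+_; _≤_; _^_)
open import Data.Fin using (Fin; _≤_) renaming (zero to fzero; suc to fsuc)
open import Data.Bool using (Bool; true; false; if_then_else_)
open import Data.Product using (Σ; ∃; _×_; _,_)
open import Relation.Binary.PropositionalEquality using (_≡_)

Matrix : ℕ → ℕ → Set
Matrix m n = Fin m → Fin n → Bool

J : (r k : ℕ) → Matrix r k
J r k = λ _ _ → true

-- An interval decomposition of {0,…,m-1} into p nonempty intervals of
-- consecutive indices, given by the map sending each index to (the position
-- of) the interval containing it: a monotone surjection Fin m → Fin p.
record IntervalDecomposition (m p : ℕ) : Set where
  field
    part       : Fin m → Fin p
    monotone   : ∀ {i j} → i Data.Fin.≤ j → part i Data.Fin.≤ part j
    surjective : ∀ (a : Fin p) → ∃ λ i → part i ≡ a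

-- B (p × q) is an interval minor of A (m × n): there is a block decomposition
-- of A into p row intervals and q column intervals such that B is entrywise
-- at most the contraction of A (an entry of the contraction is 1 iff the
-- corresponding block contains a 1-entry).
IntervalMinor : ∀ {p q m n} → Matrix p q → Matrix m n → Set
IntervalMinor {p} {q} {m} {n} B A =
  Σ (IntervalDecomposition m p) λ R →
  Σ (IntervalDecomposition n q) λ C →
    ∀ (a : Fin p) (b : Fin q) → B a b ≡ true →
      ∃ λ (i : Fin m) → ∃ λ (j : Fin n) →
        (IntervalDecomposition.part R i ≡ a) ×
        (IntervalDecomposition.part C j ≡ b) × (A i j ≡ true)

ones : ∀ {n} → (Fin n → Bool) → ℕ
ones {zero}  f = 0
ones {suc n} f = (if f fzero then 1 else 0) + ones (λ j → f (fsuc j))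

IsPowerOf2 : ℕ → Set
IsPowerOf2 x = ∃ λ e → x ≡ 2 ^ e

-- Call a row rich if it has at least s = 2^d ones. In a matrix of width 2^(d+j) without a J_{r,k}
-- interval minor at most r 4^(k-1) 4^j rows are rich; when every row is rich this is the theorem,
-- as 4^j = (t/s)^2. Induct by halving the columns: a row with 2s ones has 2s ones in one half, or
-- s ones in one half and a 1 in the other. Rows of the first kind are rich rows of a half, which
-- has no J_{r,k} minor either. Rows of the second kind are s-rich rows of a half restricted to the
-- rows meeting the other half, and that restriction has no J_{r,k-1} minor, since the other half
-- would supply a k-th column interval. The four bounds add up to the bound for the whole matrix
-- exactly. For k = 1 or t = s, every rich row meets every column interval of a suitable
-- decomposition, so r rich rows would already span a J_{r,k} minor.
module Submission where

open import Defs
open import Data.Nat using (ℕ; _*_; _^_; _∸_; _≤_)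
open import Relation.Nullary using (¬_)

open import Data.Nat using (zero; suc; _+_; _<_; z≤n; s≤s; s≤s⁻¹; _≤?_; _≤ᵇ_)
open import Data.Nat.Properties
open import Data.Nat.Tactic.RingSolver using (solve-∀)
open import Algebra.Properties.CommutativeSemigroup +-commutativeSemigroup using (interchange)
open import Data.Fin as Fin
  using (Fin; toℕ; _↑ˡ_; _↑ʳ_; splitAt; join; inject≤; inject₁; fromℕ)
  renaming (zero to fzero; suc to fsuc)
open import Data.Fin.Properties
  using (toℕ<n; toℕ≤pred[n]; toℕ-↑ˡ; toℕ-↑ʳ; toℕ-inject₁; toℕ-inject≤; toℕ-fromℕ;
         splitAt-↑ˡ; splitAt-↑ʳ; join-splitAt)
open import Data.Fin.Relation.Unary.Top using (view; ‵fromℕ; ‵inject₁)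
open import Data.Bool using (Bool; true; false; if_then_else_; _∧_; _∨_)
open import Data.Bool.Properties using (∨-zeroʳ; ∧-conicalˡ; ∧-conicalʳ; T-≡)
open import Data.Product using (Σ; ∃; _×_; _,_; proj₁; proj₂)
open import Data.Sum as Sum using (_⊎_; inj₁; inj₂; [_,_]′)
open import Function using (_∘_; const)
open import Function.Bundles using (module Equivalence)
open import Relation.Binary.Core using (_Preserves_⟶_)
open import Relation.Binary.PropositionalEquality
  using (_≡_; refl; sym; trans; cong; cong₂; subst; subst₂)
open import Relation.Nullary using (yes; no; contradiction)

open IntervalDecomposition

n<2^n : ∀ n → n < 2 ^ n
n<2^n zero    = s≤s z≤n
n<2^n (suc n) = +-mono-≤ (m^n>0 2 n) (subst (suc n ≤_) (sym (+-identityʳ (2 ^ n))) (n<2^n n))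

^-cancelˡ-≤ : ∀ m {n o} → 1 < m → m ^ n ≤ m ^ o → n ≤ o
^-cancelˡ-≤ m {n} {o} 1<m mⁿ≤mᵒ with n ≤? o
... | yes n≤o = n≤o
... | no  n≰o = contradiction mⁿ≤mᵒ (<⇒≱ (^-monoʳ-< m 1<m (≰⇒> n≰o)))

2^-double : ∀ n → 2 ^ suc n ≡ 2 ^ n + 2 ^ n
2^-double n = cong (2 ^ n +_) (+-identityʳ (2 ^ n))

[2^n]²≡4^n : ∀ n → (2 ^ n) ^ 2 ≡ 4 ^ n
[2^n]²≡4^n n = trans (^-*-assoc 2 n 2) (trans (cong (2 ^_) (*-comm n 2)) (sym (^-*-assoc 2 2 n)))

bit : Bool → ℕ
bit b = if b then 1 else 0

bit-mono : ∀ {a b} → (a ≡ true → b ≡ true) → bit a ≤ bit b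
bit-mono {false} _   = z≤n
bit-mono {true}  a⇒b rewrite a⇒b refl = ≤-refl

bit-∨ : ∀ a b → bit (a ∨ b) ≤ bit a + bit b
bit-∨ true  b = s≤s z≤n
bit-∨ false b = ≤-refl

ones-≤ : ∀ {n} (f : Fin n → Bool) → ones f ≤ n
ones-≤ {zero}  f = z≤n
ones-≤ {suc n} f with f fzero
... | true  = s≤s (ones-≤ (f ∘ fsuc))
... | false = m≤n⇒m≤1+n (ones-≤ (f ∘ fsuc))

ones-full : ∀ {n} (f : Fin n → Bool) → n ≤ ones f → ∀ j → f j ≡ true
ones-full {suc n} f n≤ones j with f fzero in f0 | j
... | true  | fzero  = f0
... | true  | fsuc j = ones-full (f ∘ fsuc) (s≤s⁻¹ n≤ones) j
... | false | _      = contradiction (ones-≤ (f ∘ fsuc)) (<⇒≱ n≤ones)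

ones-nonzero : ∀ {n} (f : Fin n → Bool) → 1 ≤ ones f → ∃ λ j → f j ≡ true
ones-nonzero {suc n} f 1≤ones with f fzero in f0
... | true  = fzero , f0
... | false = let j , fj = ones-nonzero (f ∘ fsuc) 1≤ones in fsuc j , fj

ones-all : ∀ {n} (f : Fin n → Bool) → (∀ j → f j ≡ true) → ones f ≡ n
ones-all {zero}  f all = refl
ones-all {suc n} f all rewrite all fzero = cong suc (ones-all (f ∘ fsuc) (all ∘ fsuc))

ones-mono : ∀ {n} {f g : Fin n → Bool} → (∀ j → f j ≡ true → g j ≡ true) → ones f ≤ ones g
ones-mono {zero}  f⇒g = z≤n
ones-mono {suc n} f⇒g = +-mono-≤ (bit-mono (f⇒g fzero)) (ones-mono (f⇒g ∘ fsuc))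

ones-∨ : ∀ {n} (f g : Fin n → Bool) → ones (λ j → f j ∨ g j) ≤ ones f + ones g
ones-∨ {zero}  f g = z≤n
ones-∨ {suc n} f g = ≤-trans
  (+-mono-≤ (bit-∨ (f fzero) (g fzero)) (ones-∨ (f ∘ fsuc) (g ∘ fsuc)))
  (≤-reflexive (interchange (bit (f fzero)) (bit (g fzero)) (ones (f ∘ fsuc)) (ones (g ∘ fsuc))))

ones-++ : ∀ a {b} (f : Fin (a + b) → Bool) →
  ones f ≡ ones (λ x → f (x ↑ˡ b)) + ones (λ y → f (a ↑ʳ y))
ones-++ zero    f = refl
ones-++ (suc a) f =
  trans (cong (bit (f fzero) +_) (ones-++ a (f ∘ fsuc))) (sym (+-assoc (bit (f fzero)) _ _))

∨-true : ∀ {a b} → a ≡ true ⊎ b ≡ true → a ∨ b ≡ true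
∨-true         (inj₁ refl) = refl
∨-true {a = a} (inj₂ refl) = ∨-zeroʳ a

hasAtLeast : ∀ {n} → ℕ → (Fin n → Bool) → Bool
hasAtLeast s f = s ≤ᵇ ones f

hasAtLeast-sound : ∀ {n s} (f : Fin n → Bool) → hasAtLeast s f ≡ true → s ≤ ones f
hasAtLeast-sound {s = s} f has = ≤ᵇ⇒≤ s (ones f) (Equivalence.from T-≡ has)

hasAtLeast-complete : ∀ {n s} (f : Fin n → Bool) → s ≤ ones f → hasAtLeast s f ≡ true
hasAtLeast-complete f s≤ones = Equivalence.to T-≡ (≤⇒≤ᵇ s≤ones)

richRows : ∀ {m n} → ℕ → Matrix m n → ℕ
richRows s A = ones (λ i → hasAtLeast s (A i))

restrictRows : ∀ {m n} → (Fin m → Bool) → Matrix m n → Matrix m n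
restrictRows keep A i j = keep i ∧ A i j

restrictRows-true : ∀ {m n} (keep : Fin m → Bool) (A : Matrix m n) {i j} →
  restrictRows keep A i j ≡ true → keep i ≡ true × A i j ≡ true
restrictRows-true keep A e = ∧-conicalˡ _ _ e , ∧-conicalʳ _ _ e

ones-restrictRows : ∀ {m n} (keep : Fin m → Bool) (A : Matrix m n) {i} →
  keep i ≡ true → ones (restrictRows keep A i) ≡ ones (A i)
ones-restrictRows keep A kept rewrite kept = refl

2s≤x+y-cases : ∀ s x y → 2 * s ≤ x + y →
  2 * s ≤ x ⊎ 2 * s ≤ y ⊎ (1 ≤ y × s ≤ x) ⊎ (1 ≤ x × s ≤ y)
2s≤x+y-cases s x       zero    2s≤x+y = inj₁ (subst (2 * s ≤_) (+-identityʳ x) 2s≤x+y)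
2s≤x+y-cases s zero    (suc y) 2s≤x+y = inj₂ (inj₁ 2s≤x+y)
2s≤x+y-cases s (suc x) (suc y) 2s≤x+y with s ≤? suc x | s ≤? suc y
... | yes s≤x | _        = inj₂ (inj₂ (inj₁ (s≤s z≤n , s≤x)))
... | no  _   | yes s≤y  = inj₂ (inj₂ (inj₂ (s≤s z≤n , s≤y)))
... | no  s≰x | no  s≰y  = contradiction 2s≤x+y (<⇒≱ (subst (suc x + suc y <_)
    (cong (s +_) (sym (+-identityʳ s))) (+-mono-< (≰⇒> s≰x) (≰⇒> s≰y))))

clamp : ∀ {p} → ℕ → Fin (suc p)
clamp {zero}  _       = fzero
clamp {suc p} zero    = fzero
clamp {suc p} (suc n) = fsuc (clamp n)

clamp-mono : ∀ {p} → clamp {p} Preserves _≤_ ⟶ Fin._≤_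
clamp-mono {zero}                    _          = z≤n
clamp-mono {suc p} {zero}            _          = z≤n
clamp-mono {suc p} {suc x} {suc y} (s≤s x≤y) = s≤s (clamp-mono x≤y)

clamp-toℕ : ∀ {p n} {c : Fin (suc p)} → n ≡ toℕ c → clamp n ≡ c
clamp-toℕ {zero}  {c = fzero}  refl = refl
clamp-toℕ {suc p} {c = fzero}  refl = refl
clamp-toℕ {suc p} {c = fsuc c} refl = cong fsuc (clamp-toℕ refl)

fromMonotone : ∀ {m p} (g : Fin m → ℕ) → g Preserves Fin._≤_ ⟶ _≤_ →
  (∀ (c : Fin (suc p)) → ∃ λ i → g i ≡ toℕ c) → IntervalDecomposition m (suc p)
fromMonotone g mono hits = record
  { part       = clamp ∘ g
  ; monotone   = λ i≤j → clamp-mono (mono i≤j)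
  ; surjective = λ c → let i , gi≡c = hits c in i , clamp-toℕ gi≡c
  }

coarsen : ∀ {n p} → suc p ≤ n → IntervalDecomposition n (suc p)
coarsen p<n = fromMonotone toℕ (λ i≤j → i≤j) (λ c → inject≤ c p<n , toℕ-inject≤ c p<n)

countBefore : ∀ {n} → (Fin n → Bool) → Fin n → ℕ
countBefore f fzero    = 0
countBefore f (fsuc i) = bit (f fzero) + countBefore (f ∘ fsuc) i

countBefore-mono : ∀ {n} (f : Fin n → Bool) → countBefore f Preserves Fin._≤_ ⟶ _≤_
countBefore-mono f {fzero}           _          = z≤n
countBefore-mono f {fsuc i} {fsuc j} (s≤s i≤j) =
  +-monoʳ-≤ (bit (f fzero)) (countBefore-mono (f ∘ fsuc) i≤j)

countBefore-hits : ∀ {n} (f : Fin n → Bool) c → c < ones f →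
  ∃ λ i → f i ≡ true × countBefore f i ≡ c
countBefore-hits {suc n} f c c<ones with f fzero in f0
countBefore-hits {suc n} f zero    _            | true = fzero , f0 , refl
countBefore-hits {suc n} f (suc c) (s≤s c<ones) | true =
  let i , fi , count≡c = countBefore-hits (f ∘ fsuc) c c<ones
  in fsuc i , fi , cong₂ _+_ (cong bit f0) count≡c
countBefore-hits {suc n} f c       c<ones       | false =
  let i , fi , count≡c = countBefore-hits (f ∘ fsuc) c c<ones
  in fsuc i , fi , cong₂ _+_ (cong bit f0) count≡c

-- Interval c holds the indices preceded by exactly c marked ones (the last interval also takes
-- the rest), so it starts at the c-th marked index.
markedDecomposition : ∀ {m r} (f : Fin m → Bool) → suc r ≤ ones f →
  Σ (IntervalDecomposition m (suc r)) λ R → ∀ c → ∃ λ i → f i ≡ true × part R i ≡ c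
markedDecomposition f r<ones =
  fromMonotone (countBefore f) (countBefore-mono f) (λ c → let i , _ , e = marked c in i , e) ,
  λ c → let i , fi , e = marked c in i , fi , clamp-toℕ e
  where
  marked : ∀ c → ∃ λ i → f i ≡ true × countBefore f i ≡ toℕ c
  marked c = countBefore-hits f (toℕ c) (<-≤-trans (toℕ<n c) r<ones)

¬minor⇒fewRowsMeetingAllBlocks : ∀ {m n k r} {A : Matrix m n}
  (f : Fin m → Bool) (C : IntervalDecomposition n k) →
  (∀ i → f i ≡ true → ∀ c → ∃ λ j → part C j ≡ c × A i j ≡ true) →
  ¬ IntervalMinor (J (suc r) k) A → ones f ≤ r
¬minor⇒fewRowsMeetingAllBlocks {r = r} f C meets ¬minor with suc r ≤? ones f
... | no  r≮ones = m<1+n⇒m≤n (≰⇒> r≮ones)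
... | yes r<ones =
  let R , marked = markedDecomposition f r<ones
  in contradiction (R , C , λ c c′ _ → let i , fi , Ri = marked c ; j , Cj , Aij = meets i fi c′
                                        in i , j , Ri , Cj , Aij) ¬minor

module SideBySide (a b : ℕ) where

  glue : (Fin a → ℕ) → (Fin b → ℕ) → Fin (a + b) → ℕ
  glue g₁ g₂ = [ g₁ , g₂ ]′ ∘ splitAt a

  glue-↑ˡ : ∀ (g₁ : Fin a → ℕ) (g₂ : Fin b → ℕ) x → glue g₁ g₂ (x ↑ˡ b) ≡ g₁ x
  glue-↑ˡ g₁ g₂ x = cong [ g₁ , g₂ ]′ (splitAt-↑ˡ a x b)

  glue-↑ʳ : ∀ (g₁ : Fin a → ℕ) (g₂ : Fin b → ℕ) y → glue g₁ g₂ (a ↑ʳ y) ≡ g₂ y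
  glue-↑ʳ g₁ g₂ y = cong [ g₁ , g₂ ]′ (splitAt-↑ʳ a b y)

  glue-mono : ∀ {g₁ : Fin a → ℕ} {g₂ : Fin b → ℕ} →
    g₁ Preserves Fin._≤_ ⟶ _≤_ → g₂ Preserves Fin._≤_ ⟶ _≤_ → (∀ x y → g₁ x ≤ g₂ y) →
    glue g₁ g₂ Preserves Fin._≤_ ⟶ _≤_
  glue-mono {g₁} {g₂} mono₁ mono₂ g₁≤g₂ {i} {j} i≤j =
    on-halves (splitAt a i) (splitAt a j)
      (subst₂ Fin._≤_ (sym (join-splitAt a b i)) (sym (join-splitAt a b j)) i≤j)
    where
    on-halves : ∀ u v → join a b u Fin.≤ join a b v → [ g₁ , g₂ ]′ u ≤ [ g₁ , g₂ ]′ v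
    on-halves (inj₁ x) (inj₁ x′) le = mono₁ (subst₂ _≤_ (toℕ-↑ˡ x b) (toℕ-↑ˡ x′ b) le)
    on-halves (inj₁ x) (inj₂ y)  _  = g₁≤g₂ x y
    on-halves (inj₂ y) (inj₁ x)  le = contradiction (subst₂ _≤_ (toℕ-↑ʳ a y) (toℕ-↑ˡ x b) le)
      (<⇒≱ (<-≤-trans (toℕ<n x) (m≤m+n a (toℕ y))))
    on-halves (inj₂ y) (inj₂ y′) le =
      mono₂ (+-cancelˡ-≤ a _ _ (subst₂ _≤_ (toℕ-↑ʳ a y) (toℕ-↑ʳ a y′) le))

  padʳ : ∀ {q} → IntervalDecomposition a (suc q) → IntervalDecomposition (a + b) (suc q)
  padʳ {q} P = fromMonotone (glue (toℕ ∘ part P) (const q))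
    (glue-mono (monotone P) (λ _ → ≤-refl) (λ x _ → toℕ≤pred[n] (part P x)))
    (λ c → let x , e = surjective P c in x ↑ˡ b , trans (glue-↑ˡ _ _ x) (cong toℕ e))

  padʳ-↑ˡ : ∀ {q} (P : IntervalDecomposition a (suc q)) x → part (padʳ P) (x ↑ˡ b) ≡ part P x
  padʳ-↑ˡ P x = clamp-toℕ (glue-↑ˡ _ _ x)

  padˡ : ∀ {q} → IntervalDecomposition b (suc q) → IntervalDecomposition (a + b) (suc q)
  padˡ P = fromMonotone (glue (const 0) (toℕ ∘ part P))
    (glue-mono (λ _ → z≤n) (monotone P) (λ _ _ → z≤n))
    (λ c → let y , e = surjective P c in a ↑ʳ y , trans (glue-↑ʳ _ _ y) (cong toℕ e))

  padˡ-↑ʳ : ∀ {q} (P : IntervalDecomposition b (suc q)) y → part (padˡ P) (a ↑ʳ y) ≡ part P y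
  padˡ-↑ʳ P y = clamp-toℕ (glue-↑ʳ _ _ y)

  -- The points y₀ and x₀ below only witness that the new interval is nonempty.
  extendʳ : ∀ {q} → IntervalDecomposition a (suc q) → Fin b →
    IntervalDecomposition (a + b) (suc (suc q))
  extendʳ {q} P y₀ = fromMonotone (glue (toℕ ∘ part P) (const (suc q)))
    (glue-mono (monotone P) (λ _ → ≤-refl) (λ x _ → m≤n⇒m≤1+n (toℕ≤pred[n] (part P x))))
    hits
    where
    hits : ∀ c → ∃ λ i → glue (toℕ ∘ part P) (const (suc q)) i ≡ toℕ c
    hits c with view c
    ... | ‵fromℕ      = a ↑ʳ y₀ , trans (glue-↑ʳ _ _ y₀) (sym (toℕ-fromℕ (suc q)))
    ... | ‵inject₁ c′ = let x , e = surjective P c′ in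
      x ↑ˡ b , trans (glue-↑ˡ _ _ x) (trans (cong toℕ e) (sym (toℕ-inject₁ c′)))

  extendʳ-↑ˡ : ∀ {q} (P : IntervalDecomposition a (suc q)) y₀ x →
    part (extendʳ P y₀) (x ↑ˡ b) ≡ inject₁ (part P x)
  extendʳ-↑ˡ P y₀ x = clamp-toℕ (trans (glue-↑ˡ _ _ x) (sym (toℕ-inject₁ (part P x))))

  extendʳ-↑ʳ : ∀ {q} (P : IntervalDecomposition a (suc q)) y₀ y →
    part (extendʳ P y₀) (a ↑ʳ y) ≡ fromℕ (suc q)
  extendʳ-↑ʳ {q} P y₀ y = clamp-toℕ (trans (glue-↑ʳ _ _ y) (sym (toℕ-fromℕ (suc q))))

  extendˡ : ∀ {q} → Fin a → IntervalDecomposition b (suc q) →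
    IntervalDecomposition (a + b) (suc (suc q))
  extendˡ x₀ P = fromMonotone (glue (const 0) (suc ∘ toℕ ∘ part P))
    (glue-mono (λ _ → z≤n) (λ le → s≤s (monotone P le)) (λ _ _ → z≤n))
    hits
    where
    hits : ∀ c → ∃ λ i → glue (const 0) (suc ∘ toℕ ∘ part P) i ≡ toℕ c
    hits fzero    = x₀ ↑ˡ b , glue-↑ˡ _ _ x₀
    hits (fsuc c) = let y , e = surjective P c in
      a ↑ʳ y , trans (glue-↑ʳ _ _ y) (cong (suc ∘ toℕ) e)

  extendˡ-↑ˡ : ∀ {q} x₀ (P : IntervalDecomposition b (suc q)) x →
    part (extendˡ x₀ P) (x ↑ˡ b) ≡ fzero
  extendˡ-↑ˡ x₀ P x = clamp-toℕ (glue-↑ˡ _ _ x)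

  extendˡ-↑ʳ : ∀ {q} x₀ (P : IntervalDecomposition b (suc q)) y →
    part (extendˡ x₀ P) (a ↑ʳ y) ≡ fsuc (part P y)
  extendˡ-↑ʳ x₀ P y = clamp-toℕ (glue-↑ʳ _ _ y)

module Halves {m a b : ℕ} (A : Matrix m (a + b)) where

  open SideBySide a b

  left : Matrix m a
  left i x = A i (x ↑ˡ b)

  right : Matrix m b
  right i y = A i (a ↑ʳ y)

  rightMeetsRow leftMeetsRow : Fin m → Bool
  rightMeetsRow i = hasAtLeast 1 (right i)
  leftMeetsRow  i = hasAtLeast 1 (left i)

  leftWhereRight : Matrix m a
  leftWhereRight = restrictRows rightMeetsRow left

  rightWhereLeft : Matrix m b
  rightWhereLeft = restrictRows leftMeetsRow right

  richRows-halves : ∀ s → richRows (2 * s) A ≤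
    richRows (2 * s) left + (richRows (2 * s) right +
      (richRows s leftWhereRight + richRows s rightWhereLeft))
  richRows-halves s = ≤-trans (ones-mono rich-somewhere)
    (≤-trans (ones-∨ g₁ _) (+-monoʳ-≤ (ones g₁)
      (≤-trans (ones-∨ g₂ _) (+-monoʳ-≤ (ones g₂) (ones-∨ g₃ g₄)))))
    where
    g₁ g₂ g₃ g₄ : Fin m → Bool
    g₁ i = hasAtLeast (2 * s) (left i)
    g₂ i = hasAtLeast (2 * s) (right i)
    g₃ i = hasAtLeast s (leftWhereRight i)
    g₄ i = hasAtLeast s (rightWhereLeft i)

    rich-somewhere : ∀ i → hasAtLeast (2 * s) (A i) ≡ true → (g₁ i ∨ (g₂ i ∨ (g₃ i ∨ g₄ i))) ≡ true
    rich-somewhere i rich = ∨-true (Sum.map (hasAtLeast-complete (left i))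
      (∨-true ∘ Sum.map (hasAtLeast-complete (right i)) (∨-true ∘ Sum.map on-left on-right))
      (2s≤x+y-cases s (ones (left i)) (ones (right i))
        (subst (2 * s ≤_) (ones-++ a (A i)) (hasAtLeast-sound (A i) rich))))
      where
      on-left : 1 ≤ ones (right i) × s ≤ ones (left i) → g₃ i ≡ true
      on-left (1≤r , s≤l) = hasAtLeast-complete (leftWhereRight i)
        (subst (s ≤_)
          (sym (ones-restrictRows rightMeetsRow left (hasAtLeast-complete (right i) 1≤r))) s≤l)
      on-right : 1 ≤ ones (left i) × s ≤ ones (right i) → g₄ i ≡ true
      on-right (1≤l , s≤r) = hasAtLeast-complete (rightWhereLeft i)
        (subst (s ≤_)
          (sym (ones-restrictRows leftMeetsRow right (hasAtLeast-complete (left i) 1≤l))) s≤r)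

  leftWhereRight-left : ∀ {i x} → leftWhereRight i x ≡ true → left i x ≡ true
  leftWhereRight-left e = proj₂ (restrictRows-true rightMeetsRow left e)

  leftWhereRight-right : ∀ {i x} → leftWhereRight i x ≡ true → ∃ λ y → right i y ≡ true
  leftWhereRight-right {i} e = ones-nonzero (right i)
    (hasAtLeast-sound (right i) (proj₁ (restrictRows-true rightMeetsRow left e)))

  rightWhereLeft-right : ∀ {i y} → rightWhereLeft i y ≡ true → right i y ≡ true
  rightWhereLeft-right e = proj₂ (restrictRows-true leftMeetsRow right e)

  rightWhereLeft-left : ∀ {i y} → rightWhereLeft i y ≡ true → ∃ λ x → left i x ≡ true
  rightWhereLeft-left {i} e = ones-nonzero (left i)
    (hasAtLeast-sound (left i) (proj₁ (restrictRows-true leftMeetsRow right e)))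

  minor-left : ∀ {r q} → IntervalMinor (J r (suc q)) left → IntervalMinor (J r (suc q)) A
  minor-left (R , C , blocks) = R , padʳ C , λ c c′ _ →
    let i , x , Ri , Cx , Aix = blocks c c′ refl in i , x ↑ˡ b , Ri , trans (padʳ-↑ˡ C x) Cx , Aix

  minor-right : ∀ {r q} → IntervalMinor (J r (suc q)) right → IntervalMinor (J r (suc q)) A
  minor-right (R , C , blocks) = R , padˡ C , λ c c′ _ →
    let i , y , Ri , Cy , Aiy = blocks c c′ refl in i , a ↑ʳ y , Ri , trans (padˡ-↑ʳ C y) Cy , Aiy

  minor-leftWhereRight : ∀ {r q} → IntervalMinor (J (suc r) (suc q)) leftWhereRight →
    IntervalMinor (J (suc r) (suc (suc q))) A
  minor-leftWhereRight (R , C , blocks) = R , extendʳ C y₀ , blocks⁺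
    where
    y₀ : Fin b
    y₀ = let _ , _ , _ , _ , e = blocks fzero fzero refl in proj₁ (leftWhereRight-right e)
    blocks⁺ : ∀ c c′ → true ≡ true → ∃ λ i → ∃ λ j →
      part R i ≡ c × part (extendʳ C y₀) j ≡ c′ × A i j ≡ true
    blocks⁺ c c′ _ with view c′
    ... | ‵fromℕ =
      let i , _ , Ri , _ , e = blocks c fzero refl ; y , Aiy = leftWhereRight-right e
      in i , a ↑ʳ y , Ri , extendʳ-↑ʳ C y₀ y , Aiy
    ... | ‵inject₁ c″ =
      let i , x , Ri , Cx , e = blocks c c″ refl
      in i , x ↑ˡ b , Ri , trans (extendʳ-↑ˡ C y₀ x) (cong inject₁ Cx) , leftWhereRight-left e

  minor-rightWhereLeft : ∀ {r q} → IntervalMinor (J (suc r) (suc q)) rightWhereLeft →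
    IntervalMinor (J (suc r) (suc (suc q))) A
  minor-rightWhereLeft (R , C , blocks) = R , extendˡ x₀ C , blocks⁺
    where
    x₀ : Fin a
    x₀ = let _ , _ , _ , _ , e = blocks fzero fzero refl in proj₁ (rightWhereLeft-left e)
    blocks⁺ : ∀ c c′ → true ≡ true → ∃ λ i → ∃ λ j →
      part R i ≡ c × part (extendˡ x₀ C) j ≡ c′ × A i j ≡ true
    blocks⁺ c fzero _ =
      let i , _ , Ri , _ , e = blocks c fzero refl ; x , Aix = rightWhereLeft-left e
      in i , x ↑ˡ b , Ri , extendˡ-↑ˡ x₀ C x , Aix
    blocks⁺ c (fsuc c″) _ =
      let i , y , Ri , Cy , e = blocks c c″ refl
      in i , a ↑ʳ y , Ri , trans (extendˡ-↑ʳ x₀ C y) (cong fsuc Cy) , rightWhereLeft-right e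

r≤[1+r]*4^k*4^j : ∀ r k j → r ≤ suc r * 4 ^ k * 4 ^ j
r≤[1+r]*4^k*4^j r k j = ≤-trans (n≤1+n r)
  (≤-trans (m≤m*n (suc r) (4 ^ k) {{m^n≢0 4 k}}) (m≤m*n (suc r * 4 ^ k) (4 ^ j) {{m^n≢0 4 j}}))

four-quarters : ∀ R X Y →
  R * (4 * X) * Y + (R * (4 * X) * Y + (R * X * (4 * Y) + R * X * (4 * Y))) ≡ R * (4 * X) * (4 * Y)
four-quarters = solve-∀

richRows-bound : ∀ r k d j {m t} → k ≤ d → t ≡ 2 ^ (d + j) → (A : Matrix m t) →
  ¬ IntervalMinor (J (suc r) (suc k)) A → richRows (2 ^ d) A ≤ suc r * 4 ^ k * 4 ^ j
richRows-bound r zero d j {t = t} _ t≡ A ¬minor =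
  ≤-trans (¬minor⇒fewRowsMeetingAllBlocks _ (coarsen 1≤t) meets ¬minor) (r≤[1+r]*4^k*4^j r 0 j)
  where
  1≤t : 1 ≤ t
  1≤t = subst (1 ≤_) (sym t≡) (m^n>0 2 (d + j))
  meets : ∀ i → hasAtLeast (2 ^ d) (A i) ≡ true →
    ∀ c → ∃ λ y → part (coarsen 1≤t) y ≡ c × A i y ≡ true
  meets i rich fzero =
    let y , Aiy = ones-nonzero (A i) (≤-trans (m^n>0 2 d) (hasAtLeast-sound (A i) rich))
    in y , refl , Aiy
richRows-bound r (suc k) d zero {t = t} k<d t≡ A ¬minor =
  ≤-trans (¬minor⇒fewRowsMeetingAllBlocks _ C meets ¬minor) (r≤[1+r]*4^k*4^j r (suc k) 0)
  where
  t≡2^d : t ≡ 2 ^ d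
  t≡2^d = trans t≡ (cong (2 ^_) (+-identityʳ d))
  C : IntervalDecomposition t (suc (suc k))
  C = coarsen (subst (suc (suc k) ≤_) (sym t≡2^d) (≤-trans (s≤s k<d) (n<2^n d)))
  meets : ∀ i → hasAtLeast (2 ^ d) (A i) ≡ true → ∀ c → ∃ λ y → part C y ≡ c × A i y ≡ true
  meets i rich c = let y , Cy = surjective C c in
    y , Cy , ones-full (A i) (subst (_≤ ones (A i)) (sym t≡2^d) (hasAtLeast-sound (A i) rich)) y
richRows-bound r (suc k) zero (suc j) () t≡ A ¬minor
richRows-bound r (suc k) (suc d) (suc j) (s≤s k≤d) t≡ A ¬minor
  with refl ← trans t≡ (trans (cong (2 ^_) (+-suc (suc d) j)) (2^-double (suc d + j))) =
  ≤-trans (richRows-halves (2 ^ d))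
    (≤-trans (+-mono-≤ bound-left (+-mono-≤ bound-right (+-mono-≤ bound-lwr bound-rwl)))
      (≤-reflexive (four-quarters (suc r) (4 ^ k) (4 ^ j))))
  where
  h : ℕ
  h = 2 ^ (suc d + j)
  open Halves {a = h} {b = h} A
  h≡ : h ≡ 2 ^ (d + suc j)
  h≡ = cong (2 ^_) (sym (+-suc d j))
  bound-left  : richRows (2 ^ suc d) left ≤ suc r * 4 ^ suc k * 4 ^ j
  bound-right : richRows (2 ^ suc d) right ≤ suc r * 4 ^ suc k * 4 ^ j
  bound-left  = richRows-bound r (suc k) (suc d) j (s≤s k≤d) refl left (¬minor ∘ minor-left)
  bound-right = richRows-bound r (suc k) (suc d) j (s≤s k≤d) refl right (¬minor ∘ minor-right)
  bound-lwr   : richRows (2 ^ d) leftWhereRight ≤ suc r * 4 ^ k * 4 ^ suc j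
  bound-rwl   : richRows (2 ^ d) rightWhereLeft ≤ suc r * 4 ^ k * 4 ^ suc j
  bound-lwr   = richRows-bound r k d (suc j) k≤d h≡ leftWhereRight (¬minor ∘ minor-leftWhereRight)
  bound-rwl   = richRows-bound r k d (suc j) k≤d h≡ rightWhereLeft (¬minor ∘ minor-rightWhereLeft)

lemma6p1 : (r k s t : ℕ) → 1 ≤ r → 1 ≤ k →
    IsPowerOf2 t → IsPowerOf2 s → s ≤ t → 2 ^ (k ∸ 1) ≤ s →
    (m : ℕ) (A : Matrix m t) →
    (∀ i → s ≤ ones (A i)) →
    ¬ IntervalMinor (J r k) A →
    m * s ^ 2 ≤ r * 2 ^ (2 * k ∸ 2) * t ^ 2
lemma6p1 zero    k       s t ()
lemma6p1 (suc r) zero    s t _ ()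
lemma6p1 (suc r) (suc k) s t _ _ (e , refl) (d , refl) s≤t 2ᵏ≤s m A rich ¬minor
  with j , refl ← m≤n⇒∃[o]m+o≡n (^-cancelˡ-≤ 2 {d} {e} (s≤s (s≤s z≤n)) s≤t) = begin
    m * (2 ^ d) ^ 2                                ≡⟨ cong (m *_) ([2^n]²≡4^n d) ⟩
    m * 4 ^ d                                      ≤⟨ *-monoˡ-≤ (4 ^ d) m≤bound ⟩
    suc r * 4 ^ k * 4 ^ j * 4 ^ d                  ≡⟨ rearrange (suc r) (4 ^ k) (4 ^ j) (4 ^ d) ⟩
    suc r * 4 ^ k * (4 ^ d * 4 ^ j)                ≡⟨ cong₂ (λ x y → suc r * x * y) 4^k≡ 4^[d+j]≡ ⟩
    suc r * 2 ^ (2 * suc k ∸ 2) * (2 ^ (d + j)) ^ 2 ∎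
  where
  open ≤-Reasoning
  m≤bound : m ≤ suc r * 4 ^ k * 4 ^ j
  m≤bound = subst (_≤ suc r * 4 ^ k * 4 ^ j) (ones-all _ (λ i → hasAtLeast-complete (A i) (rich i)))
    (richRows-bound r k d j (^-cancelˡ-≤ 2 (s≤s (s≤s z≤n)) 2ᵏ≤s) refl A ¬minor)
  rearrange : ∀ R X Y D → R * X * Y * D ≡ R * X * (D * Y)
  rearrange = solve-∀
  4^k≡ : 4 ^ k ≡ 2 ^ (2 * suc k ∸ 2)
  4^k≡ = trans (^-*-assoc 2 2 k) (cong (λ n → 2 ^ (n ∸ 2)) (sym (*-suc 2 k)))
  4^[d+j]≡ : 4 ^ d * 4 ^ j ≡ (2 ^ (d + j)) ^ 2
  4^[d+j]≡ = trans (sym (^-distribˡ-+-* 4 d j)) (sym ([2^n]²≡4^n (d + j)))
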